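{- Let $\{r_j \pmod{m_j} : 1\le j\le \tau\}$ be a covering system of the integers, and for each $1\le j\le\tau$ let $p_j$ be a prime divisor of $2^{m_j}-1$. Then there is no positive integer $t$ such that the $2$-repdigit $k=2^t-1$ satisfies $k\equiv -2^{ -r_j}\pmod{p_j}$ for every $1\le j\le\tau$. In other words, the covering system method cannot yield a $2$-repdigit Sierpiński number.
   Context: A covering system of the integers is a finite collection of congruences $r_j \pmod{m_j}$ (with positive integer moduli $m_j$) such that every integer satisfies at least one of them. For a prime $p$ not dividing $2$, $2^{ -r}\pmod p$ denotes the inverse of $2^r$ modulo $p$. For integers $b\ge 2$, $1\le k<b$, $t\ge1$, the $b$-repdigit $k_b^{(t)}$ is $k(b^t-1)/(b-1)$ (the digit $k$ repeated $t$ times in base $b$); so the $2$-repdigits are exactly the numbers $2^t-1$. A Sierpiński number is an odd positive integer $k$ such that $k\cdot 2^n+1$ is composite for all positive integers $n$. The covering system method produces a Sierpiński number $k$ from a covering system $\{r_j\pmod{m_j}\}$ and distinct primes $p_j\mid 2^{m_j}-1$ by requiring $k$ odd, $k\equiv -2^{ -r_j}\pmod{p_j}$ for all $j$, and $k$ sufficiently large. -}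

module Defs where

open import Data.Nat using (ℕ; zero; suc; _^_; _∸_; _<_)
open import Data.Integer using (ℤ; +_; -[1+_]; _-_; _*_; -_)
import Data.Integer.Divisibility as ℤDiv
open import Data.Fin using (Fin)
open import Data.Product using (Σ; ∃; _×_)

infix 4 _≡_[mod_]
_≡_[mod_] : ℤ → ℤ → ℕ → Set
a ≡ b [mod m ] = (+ m) ℤDiv.∣ (a - b)

-- "x represents 2^{-r} (mod p)" for an integer exponent r:
--   r = n ≥ 0  :  x is an inverse of 2^n modulo p, i.e. 2^n·x ≡ 1 (mod p)
--   r = -(n+1) :  x ≡ 2^(n+1) (mod p)
IsPow2Neg : ℕ → ℤ → ℤ → Set
IsPow2Neg p (+ n)    x = (+ (2 ^ n)) * x ≡ + 1 [mod p ]
IsPow2Neg p -[1+ n ] x = x ≡ + (2 ^ suc n) [mod p ]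

CongNegInvPow2 : ℤ → ℤ → ℕ → Set
CongNegInvPow2 k r p = ∃ λ x → IsPow2Neg p r x × (k ≡ - x [mod p ])

IsCoveringSystem : (τ : ℕ) → (Fin τ → ℤ) → (Fin τ → ℕ) → Set
IsCoveringSystem τ r m =
  ((j : Fin τ) → 0 < m j) × ((n : ℤ) → ∃ λ j → n ≡ r j [mod m j ])

rep2 : ℕ → ℤ
rep2 t = + (2 ^ t ∸ 1)

{-# OPTIONS --safe #-}
module Submission where

-- Choose the congruence r_j (mod m_j) that covers 0, so that m_j ∣ r_j. As 2^{m_j} ≡ 1 (mod p_j),
-- every representative of 2^{-r_j} is ≡ 1 (mod p_j), hence 2^t - 1 ≡ -1, i.e. 2^t ≡ 0 (mod p_j).
-- But 2 is a unit modulo p_j (a positive power of it is 1), so none of its powers vanishes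
-- modulo p_j unless p_j = 1, which is not prime.

open import Defs
open import Data.Nat using (ℕ; _^_; _∸_; _≥_)
open import Data.Nat.Divisibility using (_∣_)
open import Data.Nat.Primality using (Prime)
open import Data.Integer using (ℤ)
open import Data.Fin using (Fin)
open import Data.Product using (∃; _×_)
open import Relation.Nullary using (¬_)

open import Data.Nat using (suc; zero; _≤_; z≤n; s≤s)
import Data.Nat as ℕ
open import Data.Nat.Properties using (*-comm; m∸n+n≡m; m^n>0)
open import Data.Nat.Divisibility using (divides; _∣0; ∣1⇒≡1)
open import Data.Nat.Primality using (¬prime[1])
import Data.Integer as ℤ
open import Data.Integer using (+_; -[1+_]; 0ℤ; 1ℤ; _+_; _-_; -_; _*_; ∣_∣)
open import Data.Integer.Properties
  using (∣-i∣≡∣i∣; +-minus-telescope; +-inverseʳ; +-identityˡ; *-identityˡ;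
         ^-*-assoc; ^-zeroˡ; pos-*; pos-+; m-n≡m⊖n; ⊖-≥)
import Data.Integer.Divisibility.Signed as Signed
open import Data.Integer.Tactic.RingSolver using (solve-∀)
open import Data.Product using (_,_)
open import Level using (0ℓ)
open import Relation.Binary.Bundles using (Setoid)
open import Relation.Binary.PropositionalEquality using (_≡_; refl; sym; trans; cong; subst)
import Relation.Binary.Reasoning.Setoid as SetoidReasoning

-- Agda cannot recover a and b from `a ≡ b [mod n ]`, which unfolds to a divisibility of a - b;
-- wrapping it in a record makes a and b visible to unification.
infix 4 _≈_⟨mod_⟩
record _≈_⟨mod_⟩ (a b : ℤ) (n : ℕ) : Set where
  constructor ⟦_⟧
  field
    divides-diff : + n Signed.∣ a - b

open _≈_⟨mod_⟩

module _ {n : ℕ} where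

  ≡[mod]⇒≈ : ∀ {a b} → a ≡ b [mod n ] → a ≈ b ⟨mod n ⟩
  ≡[mod]⇒≈ {a} {b} a≡b = ⟦ Signed.∣ᵤ⇒∣ {+ n} {a - b} a≡b ⟧

  ≈-refl : ∀ {a} → a ≈ a ⟨mod n ⟩
  ≈-refl {a} = ⟦ subst (+ n Signed.∣_) (sym (+-inverseʳ a)) (Signed.∣ᵤ⇒∣ (n ∣0)) ⟧

  ≈-sym : ∀ {a b} → a ≈ b ⟨mod n ⟩ → b ≈ a ⟨mod n ⟩
  ≈-sym {a} {b} ⟦ n∣a-b ⟧ = ⟦ subst (+ n Signed.∣_) (swap a b) (Signed.∣m⇒∣-m n∣a-b) ⟧
    where
    swap : ∀ a b → - (a - b) ≡ b - a
    swap = solve-∀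

  ≈-trans : ∀ {a b c} → a ≈ b ⟨mod n ⟩ → b ≈ c ⟨mod n ⟩ → a ≈ c ⟨mod n ⟩
  ≈-trans {a} {b} {c} ⟦ n∣a-b ⟧ ⟦ n∣b-c ⟧ =
    ⟦ subst (+ n Signed.∣_) (+-minus-telescope a b c) (Signed.∣m∣n⇒∣m+n n∣a-b n∣b-c) ⟧

  ≈-+-cong : ∀ {a b c d} → a ≈ b ⟨mod n ⟩ → c ≈ d ⟨mod n ⟩ → a + c ≈ b + d ⟨mod n ⟩
  ≈-+-cong {a} {b} {c} {d} ⟦ n∣a-b ⟧ ⟦ n∣c-d ⟧ =
    ⟦ subst (+ n Signed.∣_) (regroup a b c d) (Signed.∣m∣n⇒∣m+n n∣a-b n∣c-d) ⟧
    where
    regroup : ∀ a b c d → (a - b) + (c - d) ≡ (a + c) - (b + d)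
    regroup = solve-∀

  ≈-neg-cong : ∀ {a b} → a ≈ b ⟨mod n ⟩ → - a ≈ - b ⟨mod n ⟩
  ≈-neg-cong {a} {b} ⟦ n∣a-b ⟧ = ⟦ subst (+ n Signed.∣_) (negate a b) (Signed.∣m⇒∣-m n∣a-b) ⟧
    where
    negate : ∀ a b → - (a - b) ≡ - a - - b
    negate = solve-∀

  ≈-*-cong : ∀ {a b c d} → a ≈ b ⟨mod n ⟩ → c ≈ d ⟨mod n ⟩ → a * c ≈ b * d ⟨mod n ⟩
  ≈-*-cong {a} {b} {c} {d} ⟦ n∣a-b ⟧ ⟦ n∣c-d ⟧ = ⟦ subst (+ n Signed.∣_) (regroup a b c d)
    (Signed.∣m∣n⇒∣m+n (Signed.∣n⇒∣m*n a n∣c-d) (Signed.∣m⇒∣m*n d n∣a-b)) ⟧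
    where
    regroup : ∀ a b c d → a * (c - d) + (a - b) * d ≡ a * c - b * d
    regroup = solve-∀

  ≈-^-cong : ∀ {a b} → a ≈ b ⟨mod n ⟩ → ∀ k → a ℤ.^ k ≈ b ℤ.^ k ⟨mod n ⟩
  ≈-^-cong a≈b zero    = ≈-refl
  ≈-^-cong a≈b (suc k) = ≈-*-cong a≈b (≈-^-cong a≈b k)

≈⟨mod⟩-setoid : ℕ → Setoid 0ℓ 0ℓ
≈⟨mod⟩-setoid n = record
  { Carrier       = ℤ
  ; _≈_           = _≈_⟨mod n ⟩
  ; isEquivalence = record { refl = ≈-refl ; sym = ≈-sym ; trans = ≈-trans }
  }

pos-^ : ∀ a k → + (a ^ k) ≡ (+ a) ℤ.^ k
pos-^ a zero    = refl
pos-^ a (suc k) = trans (pos-* a (a ^ k)) (cong (+ a *_) (pos-^ a k))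

∣∸⇒≈ : ∀ {n a b} → b ≤ a → n ∣ a ∸ b → + a ≈ + b ⟨mod n ⟩
∣∸⇒≈ {n} {a} {b} b≤a n∣a∸b =
  ≡[mod]⇒≈ (subst (n ∣_) (cong ∣_∣ (sym (trans (m-n≡m⊖n a b) (⊖-≥ b≤a)))) n∣a∸b)

0≡r[mod]⇒∣∣r∣ : ∀ {m} r → 0ℤ ≡ r [mod m ] → m ∣ ∣ r ∣
0≡r[mod]⇒∣∣r∣ {m} r = subst (m ∣_) (trans (cong ∣_∣ (+-identityˡ (- r))) (∣-i∣≡∣i∣ r))

module _ {n : ℕ} where
  open SetoidReasoning (≈⟨mod⟩-setoid n)

  ^≈1⇒^-multiple≈1 : ∀ {a m e} → a ℤ.^ m ≈ 1ℤ ⟨mod n ⟩ → m ∣ e → a ℤ.^ e ≈ 1ℤ ⟨mod n ⟩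
  ^≈1⇒^-multiple≈1 {a} {m} a^m≈1 (divides q refl) = begin
    a ℤ.^ (q ℕ.* m)   ≡⟨ cong (a ℤ.^_) (*-comm q m) ⟩
    a ℤ.^ (m ℕ.* q)   ≡⟨ ^-*-assoc a m q ⟨
    (a ℤ.^ m) ℤ.^ q   ≈⟨ ≈-^-cong a^m≈1 q ⟩
    1ℤ ℤ.^ q          ≡⟨ ^-zeroˡ q ⟩
    1ℤ                ∎

  ^≈1∧^≈0⇒∣1 : ∀ {a m t} → 0 ℕ.< m → a ℤ.^ m ≈ 1ℤ ⟨mod n ⟩ → a ℤ.^ t ≈ 0ℤ ⟨mod n ⟩ → n ∣ 1
  ^≈1∧^≈0⇒∣1 {a} {suc m} {t} (s≤s z≤n) a^m≈1 a^t≈0 = Signed.∣⇒∣ᵤ (divides-diff 1≈0)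
    where
    1≈0 : 1ℤ ≈ 0ℤ ⟨mod n ⟩
    1≈0 = begin
      1ℤ                      ≡⟨ ^-zeroˡ t ⟨
      1ℤ ℤ.^ t                ≈⟨ ≈-^-cong a^m≈1 t ⟨
      (a ℤ.^ suc m) ℤ.^ t     ≡⟨ ^-*-assoc a (suc m) t ⟩
      a ℤ.^ (suc m ℕ.* t)     ≡⟨ cong (a ℤ.^_) (*-comm (suc m) t) ⟩
      a ℤ.^ (t ℕ.* suc m)     ≡⟨ ^-*-assoc a t (suc m) ⟨
      (a ℤ.^ t) ℤ.^ suc m     ≈⟨ ≈-^-cong a^t≈0 (suc m) ⟩
      0ℤ                      ∎

  isPow2Neg⇒≈1 : ∀ {m r x} → (+ 2) ℤ.^ m ≈ 1ℤ ⟨mod n ⟩ → 0ℤ ≡ r [mod m ] → IsPow2Neg n r x →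
                 x ≈ 1ℤ ⟨mod n ⟩
  isPow2Neg⇒≈1 {m} {+ e} {x} 2^m≈1 0≡r 2^e*x≡1 = begin
    x                 ≡⟨ *-identityˡ x ⟨
    1ℤ * x            ≈⟨ ≈-*-cong (≈-sym 2^e≈1) ≈-refl ⟩
    + (2 ^ e) * x     ≈⟨ ≡[mod]⇒≈ 2^e*x≡1 ⟩
    1ℤ                ∎
    where
    2^e≈1 : + (2 ^ e) ≈ 1ℤ ⟨mod n ⟩
    2^e≈1 = subst (_≈ 1ℤ ⟨mod n ⟩) (sym (pos-^ 2 e))
      (^≈1⇒^-multiple≈1 2^m≈1 (0≡r[mod]⇒∣∣r∣ (+ e) 0≡r))
  isPow2Neg⇒≈1 {m} { -[1+ e ]} {x} 2^m≈1 0≡r x≡2^e = begin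
    x                 ≈⟨ ≡[mod]⇒≈ x≡2^e ⟩
    + (2 ^ suc e)     ≡⟨ pos-^ 2 (suc e) ⟩
    (+ 2) ℤ.^ suc e   ≈⟨ ^≈1⇒^-multiple≈1 2^m≈1 (0≡r[mod]⇒∣∣r∣ -[1+ e ] 0≡r) ⟩
    1ℤ                ∎

rep2+1≡2^ : ∀ t → rep2 t + 1ℤ ≡ (+ 2) ℤ.^ t
rep2+1≡2^ t = trans (sym (pos-+ (2 ^ t ∸ 1) 1)) (trans (cong +_ (m∸n+n≡m (m^n>0 2 t))) (pos-^ 2 t))

theorem3p2 : (τ : ℕ) (r : Fin τ → ℤ) (m : Fin τ → ℕ) (p : Fin τ → ℕ) →
    IsCoveringSystem τ r m →
    ((j : Fin τ) → Prime (p j) × p j ∣ 2 ^ m j ∸ 1) →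
    ¬ (∃ λ t → t ≥ 1 × ((j : Fin τ) → CongNegInvPow2 (rep2 t) (r j) (p j)))
theorem3p2 τ r m p (0<m , covers) p-prime-divisor (t , _ , k≡-2^-r) with covers 0ℤ
... | j , 0≡rⱼ with k≡-2^-r j | p-prime-divisor j
... | x , x≡2^-rⱼ , k≡-x | pⱼ-prime , pⱼ∣2^mⱼ-1 = ¬prime[1] (subst Prime (∣1⇒≡1 pⱼ∣1) pⱼ-prime)
  where
  open SetoidReasoning (≈⟨mod⟩-setoid (p j))

  2^mⱼ≈1 : (+ 2) ℤ.^ m j ≈ 1ℤ ⟨mod p j ⟩
  2^mⱼ≈1 = subst (_≈ 1ℤ ⟨mod p j ⟩) (pos-^ 2 (m j)) (∣∸⇒≈ (m^n>0 2 (m j)) pⱼ∣2^mⱼ-1)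

  x≈1 : x ≈ 1ℤ ⟨mod p j ⟩
  x≈1 = isPow2Neg⇒≈1 2^mⱼ≈1 0≡rⱼ x≡2^-rⱼ

  k≈-x : rep2 t ≈ - x ⟨mod p j ⟩
  k≈-x = ≡[mod]⇒≈ k≡-x

  2^t≈0 : (+ 2) ℤ.^ t ≈ 0ℤ ⟨mod p j ⟩
  2^t≈0 = begin
    (+ 2) ℤ.^ t    ≡⟨ rep2+1≡2^ t ⟨
    rep2 t + 1ℤ    ≈⟨ ≈-+-cong k≈-x ≈-refl ⟩
    - x + 1ℤ       ≈⟨ ≈-+-cong (≈-neg-cong x≈1) ≈-refl ⟩
    - 1ℤ + 1ℤ      ∎

  pⱼ∣1 : p j ∣ 1
  pⱼ∣1 = ^≈1∧^≈0⇒∣1 {t = t} (0<m j) 2^mⱼ≈1 2^t≈0
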